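{- There is a positive constant $c$ such that for every $n$ and every $L>0$, at most a $2^{ -L}$ fraction of the permutations $X\in S_n$ satisfy $\mathrm{OPT}(X)\le(\log_2 n!-L-n-1)/c$.
   Context: Binary search tree model: a BST on keys $[n]$ serves the access sequence $X=(x_1,\dots,x_n)$. Starting from an initial BST, each access of key $x$ is served by selecting a connected subtree containing the root and $x$, of some size $k$ (the cost of the access is $k$), and replacing it by any BST on the same keys (the remaining subtrees being reattached in the unique valid way). $\mathrm{OPT}(X)$ is the minimum total cost of serving $X$ over all initial trees and all (offline) choices of these operations.
   Formalization: The parameter L ranges only over the positive rationals, and the constant c is taken in the rationals. -}

module Defs where

open import Data.Nat using (ℕ; zero; suc; _+_; _*_; _∸_; _^_; _≤_; _<_; _!)
open import Data.Fin using (Fin; toℕ)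
open import Data.Vec using (Vec; take; drop; toList)
open import Data.List using (List; []; _∷_; length)
open import Data.List.Relation.Unary.All using (All)
open import Data.List.Relation.Unary.Unique.Propositional using (Unique)
open import Data.Product using (Σ; ∃; ∃-syntax; _×_; _,_)
open import Data.Unit using (⊤)
open import Data.Empty using (⊥)
open import Relation.Binary.PropositionalEquality using (_≡_)

-- A BST on keys {0,…,n-1} is an (unlabelled) binary tree with n nodes;
-- the key of a node is its in-order rank (the labelling is forced).
data Tree : Set where
  leaf : Tree
  node : Tree → Tree → Tree

size : Tree → ℕ
size leaf       = 0
size (node l r) = suc (size l + size r)

-- A "top part" shape with m external leaves (hence m ∸ 1 internal nodes).
data Shape : ℕ → Set where
  hole : Shape 1
  node : ∀ {a b} → Shape a → Shape b → Shape (a + b)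

fill : ∀ {m} → Shape m → Vec Tree m → Tree
fill hole (t Data.Vec.∷ Data.Vec.[]) = t
fill (node {a} {b} l r) v = node (fill l (take a v)) (fill r (drop a v))

-- InTop P v x : the node of rank x in (fill P v) is an internal node of P.
-- Three-way case split: rank x compared with s (size of the left part).
split3 : ℕ → ℕ → (ℕ → Set) → Set → (ℕ → Set) → Set
split3 zero    zero    L E R = E
split3 zero    (suc s) L E R = L zero
split3 (suc x) zero    L E R = R x
split3 (suc x) (suc s) L E R = split3 x s (λ y → L (suc y)) E R

-- split3 x s L E R is  L x  if x < s,  E  if x = s,  R (x ∸ s ∸ 1)  if x > s.

InTop : ∀ {m} → Shape m → Vec Tree m → ℕ → Set
InTop hole v x = ⊥
InTop (node {a} {b} l r) v x =
  split3 x (size (fill l (take a v))) (InTop l (take a v)) ⊤ (InTop r (drop a v))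

-- T = P[t₁,…,t_m] with x in the top part P (connected, containing the root),
-- P has k = m ∸ 1 nodes, and T' = P'[t₁,…,t_m] for an arbitrary shape P'
-- on the same number of keys (hanging subtrees reattached in order).
Step : ℕ → Tree → ℕ → Tree → Set
Step x T k T' =
  ∃[ m ] Σ (Shape m) λ P → Σ (Shape m) λ P' → Σ (Vec Tree m) λ v →
    (T ≡ fill P v) × (T' ≡ fill P' v) × InTop P v x × (k ≡ m ∸ 1)

data Serves : List ℕ → Tree → ℕ → Set where
  done : ∀ {T} → Serves [] T 0
  step : ∀ {x xs T T' k c} → Step x T k T' → Serves xs T' c →
         Serves (x ∷ xs) T (k + c)

OPT≤ : (n : ℕ) → Vec (Fin n) n → ℕ → Set
OPT≤ n X B = Σ Tree λ T → (size T ≡ n) ×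
  ∃[ c ] (c ≤ B × Serves (Data.List.map toℕ (toList X)) T c)

IsPerm : ∀ {n} → Vec (Fin n) n → Set
IsPerm X = Unique (toList X)

module Submission where

-- An encoding (incompressibility) argument.  If OPT(X) ≤ B, then X can be
-- recovered from a bit string of length 8·B + n + 1: write down the initial
-- tree (2n + 1 bits) and, for every access, the shape of the replaced top
-- part, the shape of its replacement, and the path to the accessed node
-- inside it (at most 7 bits per unit of cost).  All three pieces are
-- prefix-free codes, so the string determines the whole serving, hence X.
-- Distinct sequences therefore get distinct strings, and at most 2^(8B+n+1)
-- of them have OPT ≤ B.  With c = 8 this is the claimed 2^(−L) bound.

open import Defs
open import Data.Nat using (ℕ; zero; suc; _+_; _*_; _∸_; _^_; _≤_; _<_; z≤n; s≤s; _!; _≤?_)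
open import Data.Nat.Properties
open import Data.Nat.Tactic.RingSolver using (solve-∀)
open import Data.Bool using (Bool; true; false)
open import Data.Fin using (Fin; toℕ)
open import Data.Fin.Properties using (toℕ-injective)
open import Data.Vec using (Vec; []; _∷_; take; drop; toList) renaming (_++_ to _++ᵥ_)
open import Data.Vec.Properties using (take++drop≡id; toList-injective; length-toList)
open import Data.Vec.Relation.Binary.Equality.Cast using (cast-is-id)
open import Data.List using (List; length; map; replicate) renaming ([] to []ₗ; _∷_ to _∷ₗ_; _++_ to _++ₗ_)
open import Data.List.Properties using (length-++; length-map; length-replicate; length-removeAt′; map-injective; ∷-injectiveʳ)
open import Data.List.Relation.Unary.All as All using (All) renaming ([] to []ᵃ; _∷_ to _∷ᵃ_)
open import Data.List.Relation.Unary.Any using (here; there; index; _─_)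
open import Data.List.Relation.Unary.AllPairs using () renaming ([] to []ᵘ; _∷_ to _∷ᵘ_)
open import Data.List.Relation.Unary.Unique.Propositional using (Unique)
open import Data.List.Membership.Propositional using (_∈_)
open import Data.List.Membership.Propositional.Properties using (∈-++⁺ˡ; ∈-++⁺ʳ; ∈-map⁺)
open import Data.Product using (Σ; ∃-syntax; _×_; _,_; proj₁; proj₂)
open import Data.Sum using (_⊎_; inj₁; inj₂)
open import Data.Empty using (⊥-elim)
open import Relation.Nullary using (yes; no)
open import Relation.Binary.PropositionalEquality

-- Counting objects with injective codes.

∈-─ : ∀ {A : Set} {x y : A} {ys : List A} (p : x ∈ ys) → y ∈ ys → y ≢ x → y ∈ (ys ─ p)
∈-─ (here refl) (here refl) y≢x = ⊥-elim (y≢x refl)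
∈-─ (here refl) (there q)   _   = q
∈-─ (there p)   (here e)    _   = here e
∈-─ (there p)   (there q)   y≢x = there (∈-─ p q y≢x)

coded-count : ∀ {A C : Set} {R : A → C → Set} →
  (∀ {x y w} → R x w → R y w → x ≡ y) →
  ∀ {xs} → Unique xs → (ws : List C) → All (λ x → ∃[ w ] (w ∈ ws × R x w)) xs →
  length xs ≤ length ws
coded-count inj []ᵘ ws []ᵃ = z≤n
coded-count {R = R} inj {x ∷ₗ _} (x≢xs ∷ᵘ unique) ws ((w , w∈ws , xRw) ∷ᵃ coded) =
  ≤-trans (s≤s (coded-count inj unique (ws ─ w∈ws) (All.zipWith shrink (x≢xs , coded))))
          (≤-reflexive (sym (length-removeAt′ ws (index w∈ws))))
  where
  -- the code word of x is not the code word of any other object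
  shrink : ∀ {y} → x ≢ y × ∃[ w′ ] (w′ ∈ ws × R y w′) → ∃[ w′ ] (w′ ∈ (ws ─ w∈ws) × R y w′)
  shrink (x≢y , w′ , w′∈ws , yRw′) =
    w′ , ∈-─ w∈ws w′∈ws (λ { refl → x≢y (inj xRw yRw′) }) , yRw′

bitStrings : ℕ → List (List Bool)
bitStrings zero    = []ₗ ∷ₗ []ₗ
bitStrings (suc L) = map (true ∷ₗ_) (bitStrings L) ++ₗ map (false ∷ₗ_) (bitStrings L)

length-bitStrings : ∀ L → length (bitStrings L) ≡ 2 ^ L
length-bitStrings zero    = refl
length-bitStrings (suc L) = begin
  length (map (true ∷ₗ_) (bitStrings L) ++ₗ map (false ∷ₗ_) (bitStrings L))
    ≡⟨ length-++ (map (true ∷ₗ_) (bitStrings L)) ⟩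
  length (map (true ∷ₗ_) (bitStrings L)) + length (map (false ∷ₗ_) (bitStrings L))
    ≡⟨ cong₂ _+_ (length-map (true ∷ₗ_) (bitStrings L)) (length-map (false ∷ₗ_) (bitStrings L)) ⟩
  length (bitStrings L) + length (bitStrings L)
    ≡⟨ cong (λ k → k + k) (length-bitStrings L) ⟩
  2 ^ L + 2 ^ L
    ≡⟨ cong (2 ^ L +_) (sym (+-identityʳ (2 ^ L))) ⟩
  2 ^ suc L ∎
  where open ≡-Reasoning

∈-bitStrings : ∀ w → w ∈ bitStrings (length w)
∈-bitStrings []ₗ           = here refl
∈-bitStrings (true ∷ₗ w)  = ∈-++⁺ˡ (∈-map⁺ (true ∷ₗ_) (∈-bitStrings w))
∈-bitStrings (false ∷ₗ w) = ∈-++⁺ʳ _ (∈-map⁺ (false ∷ₗ_) (∈-bitStrings w))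

few-codes : ∀ {A : Set} {R : A → List Bool → Set} (L : ℕ) →
  (∀ {x y w} → R x w → R y w → x ≡ y) →
  ∀ {xs} → Unique xs → All (λ x → ∃[ w ] (length w ≡ L × R x w)) xs →
  length xs ≤ 2 ^ L
few-codes {R = R} L inj unique coded =
  ≤-trans (coded-count inj unique (bitStrings L) (All.map listed coded))
          (≤-reflexive (length-bitStrings L))
  where
  listed : ∀ {x} → ∃[ w ] (length w ≡ L × R x w) → ∃[ w ] (w ∈ bitStrings L × R x w)
  listed (w , refl , xRw) = w , ∈-bitStrings w , xRw

-- Prefix-free codes.  A code is written in front of an arbitrary tail r,
-- and the decodability statements say that the encoded object and the tail
-- are both determined by the resulting string.

treeCode : Tree → List Bool → List Bool
treeCode leaf       r = false ∷ₗ r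
treeCode (node t u) r = true ∷ₗ treeCode t (treeCode u r)

treeCode-prefixFree : ∀ t t′ {r r′} → treeCode t r ≡ treeCode t′ r′ → t ≡ t′ × r ≡ r′
treeCode-prefixFree leaf       leaf         refl = refl , refl
treeCode-prefixFree leaf       (node _ _)   ()
treeCode-prefixFree (node _ _) leaf         ()
treeCode-prefixFree (node t u) (node t′ u′) eq
  with treeCode-prefixFree t t′ (∷-injectiveʳ eq)
... | refl , eq′ with treeCode-prefixFree u u′ eq′
... | refl , eq″ = refl , eq″

length-treeCode : ∀ t r → length (treeCode t r) ≡ suc (2 * size t) + length r
length-treeCode leaf       r = refl
length-treeCode (node t u) r
  rewrite length-treeCode t (treeCode u r) | length-treeCode u r =
  cong suc (regroup (size t) (size u) (length r))
  where
  regroup : ∀ a b ρ → suc (2 * a) + (suc (2 * b) + ρ) ≡ 2 * suc (a + b) + ρ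
  regroup = solve-∀

data Path : Set where
  root        : Path
  left right  : Path → Path

depth : Path → ℕ
depth root      = 0
depth (left π)  = suc (depth π)
depth (right π) = suc (depth π)

pathCode : Path → List Bool → List Bool
pathCode root      r = false ∷ₗ r
pathCode (left π)  r = true ∷ₗ false ∷ₗ pathCode π r
pathCode (right π) r = true ∷ₗ true ∷ₗ pathCode π r

pathCode-prefixFree : ∀ π π′ {r r′} → pathCode π r ≡ pathCode π′ r′ → π ≡ π′ × r ≡ r′
pathCode-prefixFree root      root       refl = refl , refl
pathCode-prefixFree root      (left _)   ()
pathCode-prefixFree root      (right _)  ()
pathCode-prefixFree (left _)  root       ()
pathCode-prefixFree (left _)  (right _)  ()
pathCode-prefixFree (right _) root       ()
pathCode-prefixFree (right _) (left _)   ()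
pathCode-prefixFree (left π)  (left π′)  eq with pathCode-prefixFree π π′ (∷-injectiveʳ (∷-injectiveʳ eq))
... | refl , eq′ = refl , eq′
pathCode-prefixFree (right π) (right π′) eq with pathCode-prefixFree π π′ (∷-injectiveʳ (∷-injectiveʳ eq))
... | refl , eq′ = refl , eq′

one-step-deeper : ∀ d ρ → 2 + (suc (2 * d) + ρ) ≡ suc (2 * suc d) + ρ
one-step-deeper = solve-∀

length-pathCode : ∀ π r → length (pathCode π r) ≡ suc (2 * depth π) + length r
length-pathCode root      r = refl
length-pathCode (left π)  r = trans (cong (2 +_) (length-pathCode π r)) (one-step-deeper (depth π) (length r))
length-pathCode (right π) r = trans (cong (2 +_) (length-pathCode π r)) (one-step-deeper (depth π) (length r))

-- Anatomy of one access.

-- The top part of a tree as a tree: its holes become leaves.  Its nodes are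
-- the keys touched by the access.
skeleton : ∀ {m} → Shape m → Tree
skeleton hole       = leaf
skeleton (node l r) = node (skeleton l) (skeleton r)

inner : ∀ {m} → Shape m → ℕ
inner P = size (skeleton P)

node-injective : ∀ {t u t′ u′} → Tree.node t u ≡ node t′ u′ → t ≡ t′ × u ≡ u′
node-injective refl = refl , refl

skeleton-injective : ∀ {m k} (P : Shape m) (Q : Shape k) →
  skeleton P ≡ skeleton Q → _≡_ {A = Σ ℕ Shape} (m , P) (k , Q)
skeleton-injective hole       hole         refl = refl
skeleton-injective hole       (node _ _)   ()
skeleton-injective (node _ _) hole         ()
skeleton-injective (node l r) (node l′ r′) eq
  with skeleton-injective l l′ (proj₁ (node-injective eq))
     | skeleton-injective r r′ (proj₂ (node-injective eq))
... | refl | refl = refl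

arity : ∀ {m} (P : Shape m) → m ≡ suc (inner P)
arity hole       = refl
arity (node l r) = trans (cong₂ _+_ (arity l) (arity r)) (cong suc (+-suc (inner l) (inner r)))

inner-arity : ∀ {m} (P : Shape m) → inner P ≡ m ∸ 1
inner-arity P = sym (cong (_∸ 1) (arity P))

fill-injective : ∀ {m} (P : Shape m) {v w : Vec Tree m} → fill P v ≡ fill P w → v ≡ w
fill-injective hole {t ∷ []} {u ∷ []} eq = cong (_∷ []) eq
fill-injective (node {a} l r) {v} {w} eq = begin
  v                       ≡⟨ sym (take++drop≡id a v) ⟩
  take a v ++ᵥ drop a v   ≡⟨ cong₂ _++ᵥ_ (fill-injective l (proj₁ halves)) (fill-injective r (proj₂ halves)) ⟩
  take a w ++ᵥ drop a w   ≡⟨ take++drop≡id a w ⟩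
  w                       ∎
  where
  open ≡-Reasoning
  halves = node-injective eq

rank : ∀ {m} → Shape m → Vec Tree m → Path → ℕ
rank hole                 v π         = 0
rank (node {a} l r) v root      = size (fill l (take a v))
rank (node {a} l r) v (left π)  = rank l (take a v) π
rank (node {a} l r) v (right π) = suc (size (fill l (take a v)) + rank r (drop a v) π)

split3-cases : ∀ x s {L : ℕ → Set} {E : Set} {R : ℕ → Set} → split3 x s L E R →
  L x ⊎ (x ≡ s) ⊎ ∃[ y ] (x ≡ suc (s + y) × R y)
split3-cases zero    zero    e = inj₂ (inj₁ refl)
split3-cases zero    (suc s) l = inj₁ l
split3-cases (suc x) zero    r = inj₂ (inj₂ (x , refl , r))
split3-cases (suc x) (suc s) p with split3-cases x s p
... | inj₁ l                  = inj₁ l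
... | inj₂ (inj₁ e)           = inj₂ (inj₁ (cong suc e))
... | inj₂ (inj₂ (y , e , r)) = inj₂ (inj₂ (y , cong suc e , r))

record Address {m} (P : Shape m) (v : Vec Tree m) (x : ℕ) : Set where
  constructor address
  field
    path    : Path
    reaches : rank P v path ≡ x
    shallow : depth path < inner P
open Address

locate : ∀ {m} (P : Shape m) (v : Vec Tree m) {x} → InTop P v x → Address P v x
locate hole v ()
locate (node {a} l r) v {x} inTop with split3-cases x (size (fill l (take a v))) inTop
... | inj₁ inLeft
  with address π e d< ← locate l (take a v) inLeft =
  address (left π) e (s≤s (≤-trans d< (m≤m+n (inner l) (inner r))))
... | inj₂ (inj₁ e) = address root (sym e) (s≤s z≤n)
... | inj₂ (inj₂ (y , e , inRight))
  with address π e′ d< ← locate r (drop a v) inRight =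
  address (right π) (trans (cong (λ z → suc (size (fill l (take a v)) + z)) e′) (sym e))
          (s≤s (≤-trans d< (m≤n+m (inner r) (inner l))))

-- Code of a serving.

stepCode : ∀ {x T k T′} → Step x T k T′ → List Bool → List Bool
stepCode (m , P , Q , v , _ , _ , inTop , _) r =
  treeCode (skeleton P) (treeCode (skeleton Q) (pathCode (path (locate P v inTop)) r))

step-determined : ∀ {x x′ T k k′ T′ T″} (st : Step x T k T′) (st′ : Step x′ T k′ T″) {r r′} →
  stepCode st r ≡ stepCode st′ r′ → x ≡ x′ × T′ ≡ T″ × r ≡ r′
step-determined (m , P , Q , v , refl , refl , inTop , _) (m′ , P′ , Q′ , v′ , sameTree , refl , inTop′ , _) eq
  with treeCode-prefixFree (skeleton P) (skeleton P′) eq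
... | sameP , eq₁ with skeleton-injective P P′ sameP
... | refl with treeCode-prefixFree (skeleton Q) (skeleton Q′) eq₁
... | sameQ , eq₂ with skeleton-injective Q Q′ sameQ
... | refl with fill-injective P sameTree
... | refl with pathCode-prefixFree (path (locate P v inTop)) (path (locate P v inTop′)) eq₂
... | samePath , eq₃ =
  trans (sym (reaches (locate P v inTop)))
        (trans (cong (rank P v) samePath) (reaches (locate P v inTop′))) ,
  refl , eq₃

servesCode : ∀ {xs T c} → Serves xs T c → List Bool → List Bool
servesCode done         r = r
servesCode (step st s) r = stepCode st (servesCode s r)

serves-determined : ∀ {xs ys T c d} (s : Serves xs T c) (s′ : Serves ys T d) {r r′} →
  length xs ≡ length ys → servesCode s r ≡ servesCode s′ r′ → xs ≡ ys
serves-determined done         done          _   _  = refl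
serves-determined done         (step _ _)    ()  _
serves-determined (step _ _)   done          ()  _
serves-determined (step st s) (step st′ s′) len eq with step-determined st st′ eq
... | refl , refl , eq′ = cong (_ ∷ₗ_) (serves-determined s s′ (suc-injective len) eq′)

stepBits : ∀ {x T k T′} → Step x T k T′ → ℕ
stepBits (m , P , Q , v , _ , _ , inTop , _) =
  suc (2 * inner P) + (suc (2 * inner Q) + suc (2 * depth (path (locate P v inTop))))

length-stepCode : ∀ {x T k T′} (st : Step x T k T′) r → length (stepCode st r) ≡ stepBits st + length r
length-stepCode (m , P , Q , v , _ , _ , inTop , _) r
  rewrite length-treeCode (skeleton P) (treeCode (skeleton Q) (pathCode (path (locate P v inTop)) r))
        | length-treeCode (skeleton Q) (pathCode (path (locate P v inTop)) r)
        | length-pathCode (path (locate P v inTop)) r =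
  regroup (suc (2 * inner P)) (suc (2 * inner Q)) (suc (2 * depth (path (locate P v inTop)))) (length r)
  where
  regroup : ∀ a b c ρ → a + (b + (c + ρ)) ≡ a + (b + c) + ρ
  regroup = solve-∀

three-codes-bound : ∀ {k d} → d < k → suc (2 * k) + (suc (2 * k) + suc (2 * d)) ≤ 7 * k
three-codes-bound {suc j} {d} (s≤s d≤j) =
  ≤-trans (+-monoʳ-≤ (suc (2 * suc j)) (+-monoʳ-≤ (suc (2 * suc j)) (s≤s (*-monoʳ-≤ 2 d≤j))))
          (≤-trans (m≤n+m _ j) (≤-reflexive (regroup j)))
  where
  regroup : ∀ j → j + (suc (2 * suc j) + (suc (2 * suc j) + suc (2 * j))) ≡ 7 * suc j
  regroup = solve-∀

stepBits-bound : ∀ {x T k T′} (st : Step x T k T′) → stepBits st ≤ 7 * k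
stepBits-bound (m , P , Q , v , _ , _ , inTop , refl)
  rewrite inner-arity P | inner-arity Q =
  three-codes-bound (subst (depth (path (locate P v inTop)) <_) (inner-arity P) (shallow (locate P v inTop)))

-- Every access costs at least one (the accessed key is a node of the top part).
step-cost-positive : ∀ {x T k T′} → Step x T k T′ → 1 ≤ k
step-cost-positive (m , P , Q , v , _ , _ , inTop , refl) =
  subst (1 ≤_) (inner-arity P) (≤-trans (s≤s z≤n) (shallow (locate P v inTop)))

servesBits : ∀ {xs T c} → Serves xs T c → ℕ
servesBits done         = 0
servesBits (step st s) = stepBits st + servesBits s

length-servesCode : ∀ {xs T c} (s : Serves xs T c) r → length (servesCode s r) ≡ servesBits s + length r
length-servesCode done         r = refl
length-servesCode (step st s) r = begin
  length (stepCode st (servesCode s r))     ≡⟨ length-stepCode st (servesCode s r) ⟩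
  stepBits st + length (servesCode s r)     ≡⟨ cong (stepBits st +_) (length-servesCode s r) ⟩
  stepBits st + (servesBits s + length r)   ≡⟨ sym (+-assoc (stepBits st) (servesBits s) (length r)) ⟩
  servesBits (step st s) + length r         ∎
  where open ≡-Reasoning

servesBits-bound : ∀ {xs T c} (s : Serves xs T c) → servesBits s ≤ 7 * c
servesBits-bound done = z≤n
servesBits-bound (step {k = k} {c = c} st s) =
  ≤-trans (+-mono-≤ (stepBits-bound st) (servesBits-bound s)) (≤-reflexive (sym (*-distribˡ-+ 7 k c)))

accesses≤cost : ∀ {xs T c} → Serves xs T c → length xs ≤ c
accesses≤cost done         = z≤n
accesses≤cost (step st s) = +-mono-≤ (step-cost-positive st) (accesses≤cost s)

-- Code of an access sequence.

keys : ∀ {n} → Vec (Fin n) n → List ℕ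
keys X = map toℕ (toList X)

length-keys : ∀ {n} (X : Vec (Fin n) n) → length (keys X) ≡ n
length-keys X = trans (length-map toℕ (toList X)) (length-toList X)

keys-injective : ∀ {n} {X Y : Vec (Fin n) n} → keys X ≡ keys Y → X ≡ Y
keys-injective {X = X} {Y} eq =
  trans (sym (cast-is-id refl X)) (toList-injective refl X Y (map-injective toℕ-injective eq))

Codes : (n : ℕ) → Vec (Fin n) n → List Bool → Set
Codes n X w = Σ Tree λ T → ∃[ c ] Σ (Serves (keys X) T c) λ s →
  ∃[ pad ] (w ≡ treeCode T (servesCode s pad))

codes-injective : ∀ {n X Y w} → Codes n X w → Codes n Y w → X ≡ Y
codes-injective {X = X} {Y} (T , _ , s , _ , refl) (T′ , _ , s′ , _ , sameCode)
  with treeCode-prefixFree T T′ sameCode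
... | refl , sameServing =
  keys-injective (serves-determined s s′ (trans (length-keys X) (sym (length-keys Y))) sameServing)

-- 2n + 1 bits for the tree and 7c ≤ 7B bits for the serving, where n ≤ c ≤ B.
code-budget : ∀ {n t B} → n ≤ B → t ≤ 7 * B → suc (2 * n) + t ≤ 8 * B + suc n
code-budget {n} {t} {B} n≤B t≤7B = begin
  suc (2 * n) + t         ≤⟨ +-monoʳ-≤ (suc (2 * n)) t≤7B ⟩
  suc (2 * n) + 7 * B     ≡⟨ regroup₁ n B ⟩
  n + 7 * B + suc n       ≤⟨ +-monoˡ-≤ (suc n) (+-monoˡ-≤ (7 * B) n≤B) ⟩
  B + 7 * B + suc n       ≡⟨ regroup₂ B n ⟩
  8 * B + suc n           ∎
  where
  open ≤-Reasoning
  regroup₁ : ∀ n B → suc (2 * n) + 7 * B ≡ n + 7 * B + suc n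
  regroup₁ = solve-∀
  regroup₂ : ∀ B n → B + 7 * B + suc n ≡ 8 * B + suc n
  regroup₂ = solve-∀

short-code : ∀ {n X B} → OPT≤ n X B → ∃[ w ] (length w ≡ 8 * B + suc n × Codes n X w)
short-code {n} {X} {B} (T , size≡n , c , c≤B , s) =
  treeCode T (servesCode s pad) , exact-length , (T , c , s , pad , refl)
  where
  used = suc (2 * size T) + servesBits s
  pad  = replicate (8 * B + suc n ∸ used) false
  fits : used ≤ 8 * B + suc n
  fits rewrite size≡n =
    code-budget (≤-trans (≤-trans (≤-reflexive (sym (length-keys X))) (accesses≤cost s)) c≤B)
                (≤-trans (servesBits-bound s) (*-monoʳ-≤ 7 c≤B))
  exact-length : length (treeCode T (servesCode s pad)) ≡ 8 * B + suc n
  exact-length = begin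
    length (treeCode T (servesCode s pad))           ≡⟨ length-treeCode T (servesCode s pad) ⟩
    suc (2 * size T) + length (servesCode s pad)     ≡⟨ cong (suc (2 * size T) +_) (length-servesCode s pad) ⟩
    suc (2 * size T) + (servesBits s + length pad)   ≡⟨ sym (+-assoc (suc (2 * size T)) (servesBits s) (length pad)) ⟩
    used + length pad                                ≡⟨ cong (used +_) (length-replicate (8 * B + suc n ∸ used)) ⟩
    used + (8 * B + suc n ∸ used)                    ≡⟨ m+[n∸m]≡n fits ⟩
    8 * B + suc n                                    ∎
    where open ≡-Reasoning

OPT≤-mono : ∀ {n X B B′} → B ≤ B′ → OPT≤ n X B → OPT≤ n X B′
OPT≤-mono B≤B′ (T , size≡n , c , c≤B , s) = T , size≡n , c , ≤-trans c≤B B≤B′ , s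

largest-witness : ∀ {A : Set} {O : A → ℕ → Set} {H : ℕ → Set} →
  (∀ {x B B′} → B ≤ B′ → O x B → O x B′) →
  ∀ {x xs} → All (λ y → ∃[ B ] (O y B × H B)) (x ∷ₗ xs) →
  ∃[ B ] (H B × All (λ y → O y B) (x ∷ₗ xs))
largest-witness mono ((B , o , h) ∷ᵃ []ᵃ) = B , h , o ∷ᵃ []ᵃ
largest-witness mono ((B , o , h) ∷ᵃ rest@(_ ∷ᵃ _))
  with B′ , h′ , os ← largest-witness mono rest with B ≤? B′
... | yes B≤B′ = B′ , h′ , mono B≤B′ o ∷ᵃ os
... | no  B≰B′ = B , h , o ∷ᵃ All.map (mono (<⇒≤ (≰⇒> B≰B′))) os

power-bound : ∀ {N} L p q → N ≤ 2 ^ L → N ^ q * 2 ^ p ≤ 2 ^ (L * q + p)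
power-bound {N} L p q N≤2^L = begin
  N ^ q * 2 ^ p          ≤⟨ *-monoˡ-≤ (2 ^ p) (^-monoˡ-≤ q N≤2^L) ⟩
  (2 ^ L) ^ q * 2 ^ p    ≡⟨ cong (_* 2 ^ p) (^-*-assoc 2 L q) ⟩
  2 ^ (L * q) * 2 ^ p    ≡⟨ sym (^-distribˡ-+-* 2 (L * q) p) ⟩
  2 ^ (L * q + p)        ∎
  where open ≤-Reasoning

few-cheap-sequences : ∀ n B {Xs : List (Vec (Fin n) n)} → Unique Xs →
  All (λ X → OPT≤ n X B) Xs → length Xs ≤ 2 ^ (8 * B + suc n)
few-cheap-sequences n B unique cheap =
  few-codes (8 * B + suc n) codes-injective unique (All.map short-code cheap)

mainTheorem17 :
    ∃[ a ] ∃[ b ] (1 ≤ a × 1 ≤ b ×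
      ((n p q : ℕ) → 1 ≤ p → 1 ≤ q → (Xs : List (Vec (Fin n) n)) → Unique Xs →
        All (λ X → IsPerm X × ∃[ B ] (OPT≤ n X B ×
              2 ^ (a * B * q + p * b + suc n * b * q) ≤ (n !) ^ (b * q))) Xs →
        length Xs ^ q * 2 ^ p ≤ (n !) ^ q))
mainTheorem17 = 8 , 1 , s≤s z≤n , s≤s z≤n , fraction-bound
  where
  exponent : ∀ B n p q → (8 * B + suc n) * q + p ≡ 8 * B * q + p * 1 + suc n * 1 * q
  exponent = solve-∀
  fraction-bound : (n p q : ℕ) → 1 ≤ p → 1 ≤ q → (Xs : List (Vec (Fin n) n)) → Unique Xs →
    All (λ X → IsPerm X × ∃[ B ] (OPT≤ n X B ×
          2 ^ (8 * B * q + p * 1 + suc n * 1 * q) ≤ (n !) ^ (1 * q))) Xs →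
    length Xs ^ q * 2 ^ p ≤ (n !) ^ q
  fraction-bound n p (suc q) _ _ []ₗ       _      _         = z≤n
  fraction-bound n p q       _ _ (_ ∷ₗ _) unique satisfied
    with B , small , cheap ← largest-witness OPT≤-mono (All.map proj₂ satisfied) =
    ≤-trans (power-bound (8 * B + suc n) p q (few-cheap-sequences n B unique cheap))
            (subst₂ _≤_ (cong (2 ^_) (sym (exponent B n p q))) (cong ((n !) ^_) (*-identityˡ q)) small)
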